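{- For every integer $n\ge 0$, $g(F_n)=\bar n$, and for every integer $n\ge 1$, $g(C_n)=\bar n\oplus 1$.
   Context: A decoration of a graph is a set of arrows on edges, at most one per edge; a vertex is a sink (source) if all its edges carry arrows into (out of) it; a state is a decoration with no sink or source at a vertex of degree $\ge2$. A follower of a state $X$ is a state $X\cup\{(v,w)\}$ with $\{v,w\}$ unmarked in $X$. Grundy value: $g(X)=\mathrm{mex}\{g(Y): Y \text{ a follower of } X\}$. $\oplus$ is nim-sum and $\bar n$ is $n \bmod 2$. For $n\ge 0$, $F_n$ is the state $\{(-1,0),(n,n+1)\}$ of the path with vertices $-1,0,1,\dots,n+1$ (consecutive integers adjacent); for $n\ge1$, $C_n$ is the state $\{(-1,0),(n+1,n)\}$ of the same path. -}

module Defs where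

open import Data.Nat using (ℕ; zero; suc; _+_; _*_; _≡ᵇ_)
open import Data.Nat.DivMod using (_%_; _/_)
open import Data.Bool using (Bool; true; false; if_then_else_; _∧_; _∨_; not)
open import Data.List using (List; []; _∷_; _++_; length; map; replicate; concat)

-- A path graph with vertices 0,1,...,e (consecutive integers adjacent)
-- has e edges; edge i joins vertices i and i+1.  A decoration assigns to
-- each edge at most one arrow:
--   none : no arrow,  fwd : arrow (i , i+1),  bwd : arrow (i+1 , i).
-- A decoration of the path with e edges is a list of length e.

data Arrow : Set where
  none fwd bwd : Arrow

Decoration : Set
Decoration = List Arrow

isNone : Arrow → Bool
isNone none = true
isNone _    = false

-- An internal vertex (degree 2) lies between its left edge a and right
-- edge b.  It is a sink iff both arrows point into it, a source iff both
-- point out of it.  Endpoints have degree 1 and are unconstrained.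
isSink : Arrow → Arrow → Bool
isSink fwd bwd = true
isSink _   _   = false

isSource : Arrow → Arrow → Bool
isSource bwd fwd = true
isSource _   _   = false

isState : Decoration → Bool
isState []           = true
isState (a ∷ [])     = true
isState (a ∷ b ∷ xs) = not (isSink a b ∨ isSource a b) ∧ isState (b ∷ xs)

setEdge : ℕ → Arrow → Decoration → Decoration
setEdge _       d []       = []
setEdge zero    d (a ∷ xs) = d ∷ xs
setEdge (suc i) d (a ∷ xs) = a ∷ setEdge i d xs

unmarkedAt : ℕ → Decoration → Bool
unmarkedAt _       []       = false
unmarkedAt zero    (a ∷ xs) = isNone a
unmarkedAt (suc i) (a ∷ xs) = unmarkedAt i xs

upTo : ℕ → List ℕ
upTo zero    = []
upTo (suc n) = upTo n ++ (n ∷ [])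

candidates : Decoration → List Decoration
candidates X =
  concat (map (λ i → if unmarkedAt i X
                     then setEdge i fwd X ∷ setEdge i bwd X ∷ []
                     else []) (upTo (length X)))

filterB : {A : Set} → (A → Bool) → List A → List A
filterB p []       = []
filterB p (x ∷ xs) = if p x then x ∷ filterB p xs else filterB p xs

followers : Decoration → List Decoration
followers X = filterB isState (candidates X)

unmarked : Decoration → ℕ
unmarked []       = zero
unmarked (a ∷ xs) = (if isNone a then 1 else 0) + unmarked xs

-- mex of a finite list of naturals (least natural not in the list;
-- it is ≤ length of the list, so length+1 steps of search suffice).
elemℕ : ℕ → List ℕ → Bool
elemℕ k []       = false
elemℕ k (x ∷ xs) = (k ≡ᵇ x) ∨ elemℕ k xs

mexSearch : ℕ → ℕ → List ℕ → ℕ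
mexSearch zero    k l = k
mexSearch (suc f) k l = if elemℕ k l then mexSearch f (suc k) l else k

mex : List ℕ → ℕ
mex l = mexSearch (suc (length l)) 0 l

-- Grundy value, by recursion on a fuel bound; every follower has one
-- fewer unmarked edge, so fuel = number of unmarked edges is exact.
grundyFuel : ℕ → Decoration → ℕ
grundyFuel zero    X = mex (map (λ _ → 0) (followers X))
grundyFuel (suc f) X = mex (map (grundyFuel f) (followers X))

grundy : Decoration → ℕ
grundy X = grundyFuel (unmarked X) X

bitXor : ℕ → ℕ → ℕ
bitXor a b = if (a % 2) ≡ᵇ (b % 2) then 0 else 1

nimSumFuel : ℕ → ℕ → ℕ → ℕ
nimSumFuel zero    a b = 0
nimSumFuel (suc f) a b = bitXor a b + 2 * nimSumFuel f (a / 2) (b / 2)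

_⊕_ : ℕ → ℕ → ℕ
a ⊕ b = nimSumFuel (a + b) a b

bar : ℕ → ℕ
bar n = n % 2

-- The path with vertices -1,0,...,n+1 is relabelled by shifting by +1,
-- so it is the path with n+2 edges; edge j (0 ≤ j ≤ n+1) joins paper
-- vertices j-1 and j.
-- F_n = {(-1,0),(n,n+1)} ;  C_n = {(-1,0),(n+1,n)}.
F : ℕ → Decoration
F n = fwd ∷ (replicate n none ++ (fwd ∷ []))

C : ℕ → Decoration
C n = fwd ∷ (replicate n none ++ (bwd ∷ []))

-- Call the orientation of an arrow 0 if it points right and 1 if it points left. For a state of a
-- path whose two end edges carry arrows a and f, the Grundy value is the parity of
--   (number of unmarked edges) + orientation a + orientation f.
-- Every move marks an unmarked edge of the interior, so it flips this parity. Conversely, when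
-- the parity is odd a move exists: scanning from the left, an unmarked edge next to a marked
-- edge of the same orientation, or next to another unmarked edge, can be marked without creating
-- a sink or a source; a lone unmarked edge between opposite arrows cannot, but skipping it keeps
-- the parity of the remaining segment odd. So every position has value 0 or 1 and mex does the
-- rest. F_n has n unmarked edges and equal end orientations; C_n has opposite ones.
module Submission where

open import Defs
open import Data.Nat using (ℕ; _≥_; zero; suc; _+_; _<_; _≡ᵇ_; s≤s; z≤n; parity)
open import Data.Nat.Properties using (m<1+n⇒m<n∨m≡n; suc-injective; +-suc; 0≢1+n)
open import Data.Parity.Base using (Parity; 0ℙ; 1ℙ; _⁻¹) renaming (_+_ to _+ℙ_)
open import Data.Parity.Properties using (⁻¹-selfInverse; suc-homo-⁻¹; +-assoc; +-identityʳ)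
open import Data.Product using (_×_; _,_; ∃; ∃₂; map₁)
open import Data.Sum using (inj₁; inj₂)
open import Data.Empty using (⊥-elim)
open import Data.Bool using (Bool; true; false; if_then_else_)
open import Data.List using (List; []; _∷_; _++_; length; map; replicate)
open import Data.List.Relation.Unary.Any using (here; there; satisfied)
open import Data.List.Relation.Unary.All using (All; []; _∷_; tabulate)
open import Data.List.Relation.Unary.All.Properties using (map⁺)
open import Data.List.Membership.Propositional using (_∈_; lose)
open import Data.List.Membership.Propositional.Properties
  using (∈-++⁺ˡ; ∈-++⁺ʳ; ∈-map⁺; ∈-concatMap⁺; ∈-concatMap⁻)
open import Relation.Binary.PropositionalEquality
  using (_≡_; refl; sym; trans; cong; cong₂; subst; module ≡-Reasoning)

∈-upTo⁺ : ∀ {i n} → i < n → i ∈ upTo n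
∈-upTo⁺ {n = suc n} i<1+n with m<1+n⇒m<n∨m≡n i<1+n
... | inj₁ i<n  = ∈-++⁺ˡ (∈-upTo⁺ i<n)
... | inj₂ refl = ∈-++⁺ʳ (upTo n) (here refl)

∈-filterB⁻ : ∀ {A : Set} (p : A → Bool) xs {y} → y ∈ filterB p xs → y ∈ xs × p y ≡ true
∈-filterB⁻ p (x ∷ xs) y∈ with p x in px | y∈
... | true  | here refl = here refl , px
... | true  | there y∈′ = map₁ there (∈-filterB⁻ p xs y∈′)
... | false | y∈′       = map₁ there (∈-filterB⁻ p xs y∈′)

∈-filterB⁺ : ∀ {A : Set} (p : A → Bool) xs {y} → y ∈ xs → p y ≡ true → y ∈ filterB p xs
∈-filterB⁺ p (x ∷ xs) (here refl) px rewrite px = here refl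
∈-filterB⁺ p (x ∷ xs) (there y∈) py with p x
... | true  = there (∈-filterB⁺ p xs y∈ py)
... | false = ∈-filterB⁺ p xs y∈ py

data Directed : Arrow → Set where
  fwd : Directed fwd
  bwd : Directed bwd

unmarkedAt⇒< : ∀ i X → unmarkedAt i X ≡ true → i < length X
unmarkedAt⇒< zero    (a ∷ X) _ = s≤s z≤n
unmarkedAt⇒< (suc i) (a ∷ X) u = s≤s (unmarkedAt⇒< i X u)

movesAt : Decoration → ℕ → List Decoration
movesAt X i = if unmarkedAt i X then setEdge i fwd X ∷ setEdge i bwd X ∷ [] else []

∈-candidates⁻ : ∀ X {Y} → Y ∈ candidates X →
  ∃₂ λ i d → Directed d × unmarkedAt i X ≡ true × Y ≡ setEdge i d X
∈-candidates⁻ X Y∈ with satisfied (∈-concatMap⁻ (movesAt X) {upTo (length X)} Y∈)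
... | i , Y∈moves with unmarkedAt i X in u
∈-candidates⁻ X Y∈ | i , here refl         | true = i , fwd , fwd , u , refl
∈-candidates⁻ X Y∈ | i , there (here refl) | true = i , bwd , bwd , u , refl

∈-candidates⁺ : ∀ X i {d} → Directed d → unmarkedAt i X ≡ true → setEdge i d X ∈ candidates X
∈-candidates⁺ X i d u =
  ∈-concatMap⁺ (movesAt X) (lose (∈-upTo⁺ (unmarkedAt⇒< i X u)) (∈-moves d))
  where
  ∈-moves : ∀ {d} → Directed d → setEdge i d X ∈ movesAt X i
  ∈-moves fwd rewrite u = here refl
  ∈-moves bwd rewrite u = there (here refl)

∈-followers⁻ : ∀ X {Y} → Y ∈ followers X →
  ∃₂ λ i d → Directed d × unmarkedAt i X ≡ true × Y ≡ setEdge i d X × isState Y ≡ true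
∈-followers⁻ X Y∈ =
  let Y∈cands , state = ∈-filterB⁻ isState (candidates X) Y∈
      i , d , d↑ , u , Y≡ = ∈-candidates⁻ X Y∈cands
  in i , d , d↑ , u , Y≡ , state

∈-followers⁺ : ∀ X i {d} → Directed d → unmarkedAt i X ≡ true →
  isState (setEdge i d X) ≡ true → setEdge i d X ∈ followers X
∈-followers⁺ X i d↑ u = ∈-filterB⁺ isState (candidates X) (∈-candidates⁺ X i d↑ u)

lastArrow : Arrow → Decoration → Arrow
lastArrow a []      = a
lastArrow a (b ∷ Z) = lastArrow b Z

orientation : Arrow → Parity
orientation bwd = 1ℙ
orientation _   = 0ℙ

outcome : Arrow → Decoration → Parity
outcome a Z = parity (unmarked Z) +ℙ (orientation a +ℙ orientation (lastArrow a Z))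

record EndsMarked (a : Arrow) (Z : Decoration) : Set where
  constructor ends
  field
    first-directed : Directed a
    last-directed  : Directed (lastArrow a Z)
    is-state       : isState (a ∷ Z) ≡ true

data Opposite : Arrow → Arrow → Set where
  fwd-bwd : Opposite fwd bwd
  bwd-fwd : Opposite bwd fwd

toℕ : Parity → ℕ
toℕ 0ℙ = 0
toℕ 1ℙ = 1

parity-suc : ∀ n → parity (suc n) ≡ parity n ⁻¹
parity-suc n = sym (⁻¹-selfInverse (suc-homo-⁻¹ n))

-- Associativity, because 1ℙ +ℙ p reduces to p ⁻¹.
⁻¹-+ : ∀ p q → p ⁻¹ +ℙ q ≡ (p +ℙ q) ⁻¹
⁻¹-+ p q = +-assoc 1ℙ p q

lastArrow-setEdge : ∀ a Z j d → Directed (lastArrow a Z) → unmarkedAt j Z ≡ true →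
  lastArrow a (setEdge j d Z) ≡ lastArrow a Z
lastArrow-setEdge a (none ∷ [])    zero    d () u
lastArrow-setEdge a (none ∷ _ ∷ _) zero    d l  u = refl
lastArrow-setEdge a (b ∷ Z)        (suc j) d l  u = lastArrow-setEdge b Z j d l u

unmarked-setEdge : ∀ Z j {d} → Directed d → unmarkedAt j Z ≡ true →
  unmarked Z ≡ suc (unmarked (setEdge j d Z))
unmarked-setEdge (none ∷ Z) zero    fwd u = refl
unmarked-setEdge (none ∷ Z) zero    bwd u = refl
unmarked-setEdge (b ∷ Z)    (suc j) d↑  u =
  trans (cong ((if isNone b then 1 else 0) +_) (unmarked-setEdge Z j d↑ u)) (+-suc _ _)

outcome-setEdge : ∀ {a} Z j {d} → Directed (lastArrow a Z) → Directed d →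
  unmarkedAt j Z ≡ true → outcome a (setEdge j d Z) ≡ outcome a Z ⁻¹
outcome-setEdge {a} Z j {d} l d↑ u = sym (⁻¹-selfInverse (sym flipped))
  where
  open ≡-Reasoning
  Z′ = setEdge j d Z
  k  = unmarked Z′
  t′ = orientation a +ℙ orientation (lastArrow a Z′)
  flipped : outcome a Z ≡ outcome a Z′ ⁻¹
  flipped = begin
    outcome a Z           ≡⟨ cong₂ (λ m f → parity m +ℙ (orientation a +ℙ orientation f))
                                   (unmarked-setEdge Z j d↑ u) (sym (lastArrow-setEdge a Z j d l u)) ⟩
    parity (suc k) +ℙ t′  ≡⟨ cong (_+ℙ t′) (parity-suc k) ⟩
    parity k ⁻¹ +ℙ t′     ≡⟨ ⁻¹-+ (parity k) t′ ⟩
    outcome a Z′ ⁻¹       ∎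

p⁻¹+[q⁻¹+r]≡p+[q+r] : ∀ p q r → p ⁻¹ +ℙ (q ⁻¹ +ℙ r) ≡ p +ℙ (q +ℙ r)
p⁻¹+[q⁻¹+r]≡p+[q+r] 0ℙ 0ℙ 0ℙ = refl
p⁻¹+[q⁻¹+r]≡p+[q+r] 0ℙ 0ℙ 1ℙ = refl
p⁻¹+[q⁻¹+r]≡p+[q+r] 0ℙ 1ℙ 0ℙ = refl
p⁻¹+[q⁻¹+r]≡p+[q+r] 0ℙ 1ℙ 1ℙ = refl
p⁻¹+[q⁻¹+r]≡p+[q+r] 1ℙ 0ℙ 0ℙ = refl
p⁻¹+[q⁻¹+r]≡p+[q+r] 1ℙ 0ℙ 1ℙ = refl
p⁻¹+[q⁻¹+r]≡p+[q+r] 1ℙ 1ℙ 0ℙ = refl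
p⁻¹+[q⁻¹+r]≡p+[q+r] 1ℙ 1ℙ 1ℙ = refl

parity[1+k]+[q⁻¹+r]≡parity[k]+[q+r] : ∀ k q r →
  parity (suc k) +ℙ (q ⁻¹ +ℙ r) ≡ parity k +ℙ (q +ℙ r)
parity[1+k]+[q⁻¹+r]≡parity[k]+[q+r] k q r =
  trans (cong (_+ℙ (q ⁻¹ +ℙ r)) (parity-suc k)) (p⁻¹+[q⁻¹+r]≡p+[q+r] (parity k) q r)

outcome-lone-gap : ∀ {a c} → Opposite a c → ∀ W → outcome a (none ∷ c ∷ W) ≡ outcome c W
outcome-lone-gap fwd-bwd W =
  parity[1+k]+[q⁻¹+r]≡parity[k]+[q+r] (unmarked W) 1ℙ (orientation (lastArrow bwd W))
outcome-lone-gap bwd-fwd W =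
  parity[1+k]+[q⁻¹+r]≡parity[k]+[q+r] (unmarked W) 0ℙ (orientation (lastArrow fwd W))

-- A follower of a ∷ Z, given by the edge of Z it marks and the arrow put there.
InnerMove : Arrow → Decoration → Set
InnerMove a Z = ∃₂ λ j d → Directed d × unmarkedAt j Z ≡ true × isState (a ∷ setEdge j d Z) ≡ true

innerMove-past-marked : ∀ {b Z} → Directed b → InnerMove b Z → InnerMove b (b ∷ Z)
innerMove-past-marked fwd (j , d , d↑ , u , s) = suc j , d , d↑ , u , s
innerMove-past-marked bwd (j , d , d↑ , u , s) = suc j , d , d↑ , u , s

innerMove-past-gap : ∀ {a c W} → Opposite a c → InnerMove c W → InnerMove a (none ∷ c ∷ W)
innerMove-past-gap fwd-bwd (j , d , d↑ , u , s) = suc (suc j) , d , d↑ , u , s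
innerMove-past-gap bwd-fwd (j , d , d↑ , u , s) = suc (suc j) , d , d↑ , u , s

innerMove-exists : ∀ {a} Z → EndsMarked a Z → outcome a Z ≡ 1ℙ → InnerMove a Z
innerMove-exists []                (ends fwd _ _)  ()
innerMove-exists []                (ends bwd _ _)  ()
innerMove-exists (none ∷ [])       (ends _ () _)   _
innerMove-exists (bwd ∷ Z)         (ends fwd _ ()) _
innerMove-exists (fwd ∷ Z)         (ends bwd _ ()) _
innerMove-exists (fwd ∷ Z)         (ends fwd l s)  o =
  innerMove-past-marked fwd (innerMove-exists Z (ends fwd l s) o)
innerMove-exists (bwd ∷ Z)         (ends bwd l s)  o =
  innerMove-past-marked bwd (innerMove-exists Z (ends bwd l s) o)
innerMove-exists (none ∷ none ∷ W) (ends fwd _ s)  _ = 0 , fwd , fwd , refl , s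
innerMove-exists (none ∷ none ∷ W) (ends bwd _ s)  _ = 0 , bwd , bwd , refl , s
innerMove-exists (none ∷ fwd ∷ W)  (ends fwd _ s)  _ = 0 , fwd , fwd , refl , s
innerMove-exists (none ∷ bwd ∷ W)  (ends bwd _ s)  _ = 0 , bwd , bwd , refl , s
innerMove-exists (none ∷ bwd ∷ W)  (ends fwd l s)  o = innerMove-past-gap fwd-bwd
  (innerMove-exists W (ends bwd l s) (trans (sym (outcome-lone-gap fwd-bwd W)) o))
innerMove-exists (none ∷ fwd ∷ W)  (ends bwd l s)  o = innerMove-past-gap bwd-fwd
  (innerMove-exists W (ends fwd l s) (trans (sym (outcome-lone-gap bwd-fwd W)) o))

follower-shape : ∀ {a Z Y} → EndsMarked a Z → Y ∈ followers (a ∷ Z) →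
  ∃ λ Z′ → Y ≡ a ∷ Z′ × EndsMarked a Z′ ×
           unmarked Z ≡ suc (unmarked Z′) × outcome a Z′ ≡ outcome a Z ⁻¹
follower-shape {a} {Z} (ends a↑ l _) Y∈ with ∈-followers⁻ (a ∷ Z) Y∈ | a↑
... | zero  , _ , _  , () , _ | fwd
... | zero  , _ , _  , () , _ | bwd
... | suc j , d , d↑ , u  , refl , s | _ =
  setEdge j d Z , refl ,
  ends a↑ (subst Directed (sym (lastArrow-setEdge a Z j d l u)) l) s ,
  unmarked-setEdge Z j d↑ u , outcome-setEdge Z j l d↑ u

elemℕ-absent : ∀ {k c} l → All (_≡ c) l → (k ≡ᵇ c) ≡ false → elemℕ k l ≡ false
elemℕ-absent []      []          _   = refl
elemℕ-absent (_ ∷ l) (refl ∷ xs) k≢c rewrite k≢c = elemℕ-absent l xs k≢c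

mex-two-valued : ∀ p l → All (_≡ toℕ (p ⁻¹)) l → (p ≡ 1ℙ → ∃ (_∈ l)) → mex l ≡ toℕ p
mex-two-valued 0ℙ []      []          _        = refl
mex-two-valued 1ℙ []      []          nonempty with nonempty refl
... | _ , ()
mex-two-valued 0ℙ (_ ∷ l) (refl ∷ xs) _ rewrite elemℕ-absent {0} l xs refl = refl
mex-two-valued 1ℙ (_ ∷ l) (refl ∷ xs) _ rewrite elemℕ-absent {1} l xs refl = refl

mex-followers : ∀ {a Z} → EndsMarked a Z → (h : Decoration → ℕ) →
  (∀ {Y} → Y ∈ followers (a ∷ Z) → h Y ≡ toℕ (outcome a Z ⁻¹)) →
  mex (map h (followers (a ∷ Z))) ≡ toℕ (outcome a Z)
mex-followers {a} {Z} e h h-followers =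
  mex-two-valued (outcome a Z) _ (map⁺ (tabulate h-followers)) follower-exists
  where
  follower-exists : outcome a Z ≡ 1ℙ → ∃ (_∈ map h (followers (a ∷ Z)))
  follower-exists odd =
    let j , d , d↑ , u , s = innerMove-exists Z e odd
    in _ , ∈-map⁺ h (∈-followers⁺ (a ∷ Z) (suc j) d↑ u s)

grundyFuel-endsMarked : ∀ f {a Z} → EndsMarked a Z → unmarked Z ≡ f →
  grundyFuel f (a ∷ Z) ≡ toℕ (outcome a Z)
grundyFuel-endsMarked zero {a} {Z} e u = mex-followers e (λ _ → 0) no-follower
  where
  no-follower : ∀ {Y} → Y ∈ followers (a ∷ Z) → 0 ≡ toℕ (outcome a Z ⁻¹)
  no-follower Y∈ with _ , _ , _ , u′ , _ ← follower-shape e Y∈ =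
    ⊥-elim (0≢1+n (trans (sym u) u′))
grundyFuel-endsMarked (suc f) {a} {Z} e u = mex-followers e (grundyFuel f) follower-value
  where
  follower-value : ∀ {Y} → Y ∈ followers (a ∷ Z) → grundyFuel f Y ≡ toℕ (outcome a Z ⁻¹)
  follower-value Y∈ with _ , refl , e′ , u′ , o ← follower-shape e Y∈ =
    trans (grundyFuel-endsMarked f e′ (suc-injective (trans (sym u′) u))) (cong toℕ o)

grundy-endsMarked : ∀ {a Z} → EndsMarked a Z → grundy (a ∷ Z) ≡ toℕ (outcome a Z)
grundy-endsMarked e@(ends fwd _ _) = grundyFuel-endsMarked _ e refl
grundy-endsMarked e@(ends bwd _ _) = grundyFuel-endsMarked _ e refl

unmarkedRun : ℕ → Arrow → Decoration
unmarkedRun n x = replicate n none ++ x ∷ []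

lastArrow-run : ∀ a n x → lastArrow a (unmarkedRun n x) ≡ x
lastArrow-run a zero    x = refl
lastArrow-run a (suc n) x = lastArrow-run none n x

unmarked-run : ∀ n {x} → Directed x → unmarked (unmarkedRun n x) ≡ n
unmarked-run zero    fwd = refl
unmarked-run zero    bwd = refl
unmarked-run (suc n) x↑  = cong suc (unmarked-run n x↑)

isState-run : ∀ n x → isState (none ∷ unmarkedRun n x) ≡ true
isState-run zero    x = refl
isState-run (suc n) x = isState-run n x

outcome-run : ∀ a n {x} → Directed x →
  outcome a (unmarkedRun n x) ≡ parity n +ℙ (orientation a +ℙ orientation x)
outcome-run a n {x} x↑ = cong₂ (λ m f → parity m +ℙ (orientation a +ℙ orientation f))
                               (unmarked-run n x↑) (lastArrow-run a n x)

endsMarked-F : ∀ n → EndsMarked fwd (unmarkedRun n fwd)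
endsMarked-F n = ends fwd (subst Directed (sym (lastArrow-run fwd n fwd)) fwd) (state n)
  where
  state : ∀ n → isState (fwd ∷ unmarkedRun n fwd) ≡ true
  state zero    = refl
  state (suc n) = isState-run n fwd

endsMarked-C : ∀ n → EndsMarked fwd (unmarkedRun (suc n) bwd)
endsMarked-C n =
  ends fwd (subst Directed (sym (lastArrow-run fwd (suc n) bwd)) bwd) (isState-run n bwd)

toℕ-parity : ∀ n → toℕ (parity n) ≡ bar n
toℕ-parity zero          = refl
toℕ-parity (suc zero)    = refl
toℕ-parity (suc (suc n)) = toℕ-parity n

toℕ-+1ℙ : ∀ p → toℕ (p +ℙ 1ℙ) ≡ toℕ p ⊕ 1
toℕ-+1ℙ 0ℙ = refl
toℕ-+1ℙ 1ℙ = refl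

mainTheorem8 : ((n : ℕ) → grundy (F n) ≡ bar n)
    × ((n : ℕ) → n ≥ 1 → grundy (C n) ≡ bar n ⊕ 1)
mainTheorem8 = grundy-F , grundy-C
  where
  open ≡-Reasoning

  grundy-F : (n : ℕ) → grundy (F n) ≡ bar n
  grundy-F n = begin
    grundy (F n)                           ≡⟨ grundy-endsMarked (endsMarked-F n) ⟩
    toℕ (outcome fwd (unmarkedRun n fwd))  ≡⟨ cong toℕ (outcome-run fwd n fwd) ⟩
    toℕ (parity n +ℙ 0ℙ)                   ≡⟨ cong toℕ (+-identityʳ (parity n)) ⟩
    toℕ (parity n)                         ≡⟨ toℕ-parity n ⟩
    bar n                                  ∎

  grundy-C : (n : ℕ) → n ≥ 1 → grundy (C n) ≡ bar n ⊕ 1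
  grundy-C n@(suc m) _ = begin
    grundy (C n)                           ≡⟨ grundy-endsMarked (endsMarked-C m) ⟩
    toℕ (outcome fwd (unmarkedRun n bwd))  ≡⟨ cong toℕ (outcome-run fwd n bwd) ⟩
    toℕ (parity n +ℙ 1ℙ)                   ≡⟨ toℕ-+1ℙ (parity n) ⟩
    toℕ (parity n) ⊕ 1                     ≡⟨ cong (_⊕ 1) (toℕ-parity n) ⟩
    bar n ⊕ 1                              ∎
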